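{- Let $r\ge 2$ be an integer that is not a perfect square, $\alpha=\sqrt{r}$, $s=\lfloor\alpha\rfloor$, $\beta=\alpha-s$, write $r=s^{2}+t$ with $1\le t\le 2s$, and let $N(r)=\#\{1\le j\le r-1:\ \{j/\alpha\}<\beta\}$. Then \[ N(r)=(s+1)(t-1)-2\sum_{k=1}^{s}\lfloor k\beta\rfloor. \]
   Context: $\{x\}=x-\lfloor x\rfloor$ denotes the fractional part. -}

module Defs where

open import Data.Nat using (ℕ; zero; suc; _+_; _*_; _∸_; _≤ᵇ_; _<_; _<?_)
open import Data.Nat.Properties using ()
open import Data.Bool using (if_then_else_)
open import Data.List using (List; length; filter; map; upTo)
open import Data.Nat.ListAction using (sum)
open import Relation.Nullary using (Dec)

-- ⌊√n⌋ : the largest m with m*m ≤ n (computed incrementally; it grows by ≤ 1 per step).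
isqrt : ℕ → ℕ
isqrt zero = zero
isqrt (suc n) with isqrt n
... | m = if suc m * suc m ≤ᵇ suc n then suc m else m

-- ⌊k·√r⌋ = ⌊√(k²r)⌋ for natural k.
floorMulSqrt : ℕ → ℕ → ℕ
floorMulSqrt r k = isqrt (k * k * r)

-- ⌊j/√r⌋ : the largest m with m²·r ≤ j² (incremental, for r ≥ 1 it grows by ≤ 1 per step).
floorDivSqrt : ℕ → ℕ → ℕ
floorDivSqrt r zero = zero
floorDivSqrt r (suc j) with floorDivSqrt r j
... | m = if suc m * suc m * r ≤ᵇ suc j * suc j then suc m else m

-- ⌊k·β⌋ with β = √r − s, s = ⌊√r⌋ :  ⌊k√r⌋ − k·s  (an integer ≥ 0).
floorMulBeta : ℕ → ℕ → ℕ
floorMulBeta r k = floorMulSqrt r k ∸ k * isqrt r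

-- The condition {j/√r} < β = √r − s, for 1 ≤ j ≤ r−1.
-- With m = ⌊j/√r⌋ (so m ≤ s since j/√r < √r), multiplying by √r > 0:
--   j/√r − m < √r − s  ⇔  (s − m)·√r < r − j  ⇔  (s − m)²·r < (r − j)²
-- (both sides nonnegative).
FracBelowBeta : ℕ → ℕ → Set
FracBelowBeta r j =
  (isqrt r ∸ floorDivSqrt r j) * (isqrt r ∸ floorDivSqrt r j) * r < (r ∸ j) * (r ∸ j)

fracBelowBeta? : (r j : ℕ) → Dec (FracBelowBeta r j)
fracBelowBeta? r j = _ <? _

N : ℕ → ℕ
N r = length (filter (fracBelowBeta? r) (map suc (upTo (r ∸ 1))))

sumFloorBeta : ℕ → ℕ → ℕ
sumFloorBeta r s = sum (map (λ i → floorMulBeta r (suc i)) (upTo s))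

{-# OPTIONS --safe #-}
module Submission where

-- Write F k = ⌊k√r⌋ and M j = ⌊j/√r⌋, and let q = r − 1. Multiplying by √r,
-- {j/√r} < √r − s becomes j + F (s − M j) < r. Since √r is irrational, the j
-- with M j = m form the block F m < j ≤ F (m + 1), and F a + F b ≤ q when
-- a + b = s while F a + F b ≥ q when a + b = s + 1. Hence block m contains
-- exactly q − F m − F (s − m) counted indices, so
-- N r = (s + 1) q − 2 Σ_{k ≤ s} F k, and F k = k s + ⌊kβ⌋ turns this into
-- the stated formula.

open import Defs
open import Data.Nat
  using (ℕ; zero; suc; _+_; _*_; _∸_; _≤_; _<_; _≤ᵇ_; _⊓_; z≤n; s≤s; s≤s⁻¹; NonZero; ≢-nonZero; ≢-nonZero⁻¹)
open import Data.Nat.Properties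
open import Data.Nat.Tactic.RingSolver using (solve-∀)
open import Data.Bool using (true; false)
open import Data.Sum using (_⊎_; inj₁; inj₂)
open import Data.Product using (_×_; _,_; proj₁; proj₂; ∃)
open import Relation.Nullary using (¬_; yes; no)
open import Relation.Unary using (Pred; Decidable)
open import Data.List using (List; [_]; _∷ʳ_; _++_; length; filter; map; upTo)
open import Data.List.Properties using (upTo-∷ʳ; map-++; filter-++; length-++; filter-accept; filter-reject)
open import Data.Nat.ListAction using (sum)
open import Data.Nat.ListAction.Properties using (sum-++)
open import Function.Bundles using (_⇔_; mk⇔; Equivalence)
open import Algebra.Properties.CommutativeSemigroup +-commutativeSemigroup using (xy∙z≈xz∙y)
open import Data.Integer as ℤ using (+_; _-_)
open import Data.Integer.Properties using (m-n≡m⊖n; ⊖-≥)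
open import Relation.Nullary.Reflects using (ofʸ; ofⁿ)
open import Relation.Binary.PropositionalEquality
  using (_≡_; _≢_; refl; sym; trans; cong; cong₂; subst; subst₂; module ≡-Reasoning)
open import Data.Nat.Divisibility using (_∣_; divides; ∣-refl)
open import Data.Nat.DivMod using (_/_; m/n*n≡m)
open import Data.Nat.GCD using (gcd; gcd[m,n]∣m; gcd[m,n]∣n; gcd[m,n]≢0)
open import Data.Nat.Coprimality using (coprime-/gcd; coprime-divisor)

m*m<n*n⇒m<n : ∀ {m n} → m * m < n * n → m < n
m*m<n*n⇒m<n h = ≰⇒> (λ n≤m → <⇒≱ h (*-mono-≤ n≤m n≤m))

m*m≤n*n⇒m≤n : ∀ {m n} → m * m ≤ n * n → m ≤ n
m*m≤n*n⇒m≤n h = ≮⇒≥ (λ n<m → <⇒≱ (*-mono-< n<m n<m) h)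

private
  [x*y]²≡x²*y² : ∀ x y → (x * y) * (x * y) ≡ (x * x) * (y * y)
  [x*y]²≡x²*y² = solve-∀

  [a*b*r]²≡a²r*b²r : ∀ a b r → (a * b * r) * (a * b * r) ≡ (a * a * r) * (b * b * r)
  [a*b*r]²≡a²r*b²r = solve-∀

  [x+y]²≡ : ∀ x y → (x + y) * (x + y) ≡ x * x + y * y + 2 * (x * y)
  [x+y]²≡ = solve-∀

  [a+b]²r≡ : ∀ a b r → (a + b) * (a + b) * r ≡ a * a * r + b * b * r + 2 * (a * b * r)
  [a+b]²r≡ = solve-∀

x*y≤a*b*r : ∀ {x a r y b} → x * x ≤ a * a * r → y * y ≤ b * b * r → x * y ≤ a * b * r
x*y≤a*b*r {x} {a} {r} {y} {b} hx hy = m*m≤n*n⇒m≤n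
  (subst₂ _≤_ (sym ([x*y]²≡x²*y² x y)) (sym ([a*b*r]²≡a²r*b²r a b r)) (*-mono-≤ hx hy))

a*b*r≤x*y : ∀ {a r x b y} → a * a * r ≤ x * x → b * b * r ≤ y * y → a * b * r ≤ x * y
a*b*r≤x*y {a} {r} {x} {b} {y} hx hy = m*m≤n*n⇒m≤n
  (subst₂ _≤_ (sym ([a*b*r]²≡a²r*b²r a b r)) (sym ([x*y]²≡x²*y² x y)) (*-mono-≤ hx hy))

[x+y]²≤[a+b]²r : ∀ {x a r y b} → x * x ≤ a * a * r → y * y ≤ b * b * r →
                 (x + y) * (x + y) ≤ (a + b) * (a + b) * r
[x+y]²≤[a+b]²r {x} {a} {r} {y} {b} hx hy = subst₂ _≤_ (sym ([x+y]²≡ x y)) (sym ([a+b]²r≡ a b r))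
  (+-mono-≤ (+-mono-≤ hx hy) (*-monoʳ-≤ 2 (x*y≤a*b*r {x} {a} {r} {y} {b} hx hy)))

[x+y]²<[a+b]²r : ∀ {x a r y b} → x * x ≤ a * a * r → y * y < b * b * r →
                 (x + y) * (x + y) < (a + b) * (a + b) * r
[x+y]²<[a+b]²r {x} {a} {r} {y} {b} hx hy = subst₂ _<_ (sym ([x+y]²≡ x y)) (sym ([a+b]²r≡ a b r))
  (+-mono-<-≤ (+-mono-≤-< hx hy) (*-monoʳ-≤ 2 (x*y≤a*b*r {x} {a} {r} {y} {b} hx (<⇒≤ hy))))

[a+b]²r<[x+y]² : ∀ {a r x b y} → a * a * r ≤ x * x → b * b * r < y * y →
                 (a + b) * (a + b) * r < (x + y) * (x + y)
[a+b]²r<[x+y]² {a} {r} {x} {b} {y} hx hy = subst₂ _<_ (sym ([a+b]²r≡ a b r)) (sym ([x+y]²≡ x y))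
  (+-mono-<-≤ (+-mono-≤-< hx hy) (*-monoʳ-≤ 2 (a*b*r≤x*y {a} {r} {x} {b} {y} hx (<⇒≤ hy))))

isqrt-spec : ∀ n → isqrt n * isqrt n ≤ n × n < suc (isqrt n) * suc (isqrt n)
isqrt-spec zero = z≤n , s≤s z≤n
isqrt-spec (suc n) with isqrt n | isqrt-spec n
... | m | (lo , hi) with suc m * suc m ≤ᵇ suc n | ≤ᵇ-reflects-≤ (suc m * suc m) (suc n)
... | true  | ofʸ le  = le , ≤-<-trans hi (*-mono-< (n<1+n (suc m)) (n<1+n (suc m)))
... | false | ofⁿ nle = m≤n⇒m≤1+n lo , ≰⇒> nle

m*m≤n⇒m≤isqrt : ∀ {m n} → m * m ≤ n → m ≤ isqrt n
m*m≤n⇒m≤isqrt {m} {n} h = ≤-pred (m*m<n*n⇒m<n (≤-<-trans h (proj₂ (isqrt-spec n))))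

n<m*m⇒isqrt<m : ∀ {m n} → n < m * m → isqrt n < m
n<m*m⇒isqrt<m {n = n} h = m*m<n*n⇒m<n (≤-<-trans (proj₁ (isqrt-spec n)) h)

isqrt<m⇒n<m*m : ∀ {m n} → isqrt n < m → n < m * m
isqrt<m⇒n<m*m {n = n} h = <-≤-trans (proj₂ (isqrt-spec n)) (*-mono-≤ h h)

isqrt-unique : ∀ {m n} → m * m ≤ n → n < suc m * suc m → isqrt n ≡ m
isqrt-unique lo hi = ≤-antisym (≤-pred (n<m*m⇒isqrt<m hi)) (m*m≤n⇒m≤isqrt lo)

floorDivSqrt-suc : ∀ r j → floorDivSqrt r (suc j) ≡ floorDivSqrt r j
                         ⊎ floorDivSqrt r (suc j) ≡ suc (floorDivSqrt r j)
floorDivSqrt-suc r j with floorDivSqrt r j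
... | m with suc m * suc m * r ≤ᵇ suc j * suc j
... | true  = inj₂ refl
... | false = inj₁ refl

floorDivSqrt-spec : ∀ r → .{{NonZero r}} → ∀ j → let m = floorDivSqrt r j in
                    m * m * r ≤ j * j × j * j < suc m * suc m * r
floorDivSqrt-spec (suc r) zero = z≤n , s≤s z≤n
floorDivSqrt-spec r@(suc _) (suc j) with floorDivSqrt r j | floorDivSqrt-spec r j
... | m | (lo , hi) with suc m * suc m * r ≤ᵇ suc j * suc j | ≤ᵇ-reflects-≤ (suc m * suc m * r) (suc j * suc j)
... | true  | ofʸ le  = le , [x+y]²<[a+b]²r {1} {1} {r} {j} {suc m} (s≤s z≤n) hi
... | false | ofⁿ nle = ≤-trans lo (*-mono-≤ (n≤1+n j) (n≤1+n j)) , ≰⇒> nle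

a*a*r≡b*b⇒∃[k]k*k≡r : ∀ a b r → .{{NonZero a}} → a * a * r ≡ b * b → ∃ λ k → k * k ≡ r
a*a*r≡b*b⇒∃[k]k*k≡r a b r a²r≡b² = b′ , sym r≡b′²
  where
  g = gcd a b
  instance
    g≢0 : NonZero g
    g≢0 = ≢-nonZero (gcd[m,n]≢0 a b (inj₁ (≢-nonZero⁻¹ a)))
    g²≢0 : NonZero (g * g)
    g²≢0 = m*n≢0 g g
  a′ = a / g
  b′ = b / g
  a′²r≡b′² : a′ * a′ * r ≡ b′ * b′
  a′²r≡b′² = *-cancelʳ-≡ (a′ * a′ * r) (b′ * b′) (g * g) (begin
    a′ * a′ * r * (g * g)    ≡⟨ regroup a′ g r ⟩
    (a′ * g) * (a′ * g) * r  ≡⟨ cong (λ c → c * c * r) (m/n*n≡m (gcd[m,n]∣m a b)) ⟩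
    a * a * r                ≡⟨ a²r≡b² ⟩
    b * b                    ≡⟨ cong (λ c → c * c) (m/n*n≡m (gcd[m,n]∣n a b)) ⟨
    (b′ * g) * (b′ * g)      ≡⟨ [x*y]²≡x²*y² b′ g ⟩
    b′ * b′ * (g * g)        ∎)
    where
    open ≡-Reasoning
    regroup : ∀ a g r → a * a * r * (g * g) ≡ (a * g) * (a * g) * r
    regroup = solve-∀
  a′∣b′ : a′ ∣ b′
  a′∣b′ = coprime-divisor (coprime-/gcd a b)
    (divides (a′ * r) (trans (sym a′²r≡b′²) (trans (*-assoc a′ a′ r) (*-comm a′ (a′ * r)))))
  a′≡1 : a′ ≡ 1
  a′≡1 = coprime-/gcd a b (∣-refl , a′∣b′)
  r≡b′² : r ≡ b′ * b′
  r≡b′² = trans (sym (*-identityˡ r)) (subst (λ c → c * c * r ≡ b′ * b′) a′≡1 a′²r≡b′²)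

map-upTo-suc : ∀ {A : Set} (f : ℕ → A) n → map f (upTo (suc n)) ≡ map f (upTo n) ∷ʳ f n
map-upTo-suc f n = trans (cong (map f) (sym (upTo-∷ʳ n))) (map-++ f (upTo n) [ n ])

sum-map-upTo-suc : ∀ (f : ℕ → ℕ) n → sum (map f (upTo (suc n))) ≡ sum (map f (upTo n)) + f n
sum-map-upTo-suc f n = begin
  sum (map f (upTo (suc n)))          ≡⟨ cong sum (map-upTo-suc f n) ⟩
  sum (map f (upTo n) ++ [ f n ])     ≡⟨ sum-++ (map f (upTo n)) [ f n ] ⟩
  sum (map f (upTo n)) + (f n + 0)    ≡⟨ cong (_+_ (sum (map f (upTo n)))) (+-identityʳ (f n)) ⟩
  sum (map f (upTo n)) + f n          ∎
  where open ≡-Reasoning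

module _ {ℓ} {A : Set} {P : Pred A ℓ} (P? : Decidable P) (xs : List A) {x : A} where

  length-filter-∷ʳ-accept : P x → length (filter P? (xs ∷ʳ x)) ≡ suc (length (filter P? xs))
  length-filter-∷ʳ-accept px = begin
    length (filter P? (xs ∷ʳ x))                      ≡⟨ cong length (filter-++ P? xs [ x ]) ⟩
    length (filter P? xs ++ filter P? [ x ])          ≡⟨ length-++ (filter P? xs) ⟩
    length (filter P? xs) + length (filter P? [ x ])  ≡⟨ cong (λ ys → ℓxs + length ys) (filter-accept P? px) ⟩
    ℓxs + 1                                           ≡⟨ +-comm ℓxs 1 ⟩
    suc ℓxs                                           ∎
    where
    open ≡-Reasoning
    ℓxs = length (filter P? xs)

  length-filter-∷ʳ-reject : ¬ P x → length (filter P? (xs ∷ʳ x)) ≡ length (filter P? xs)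
  length-filter-∷ʳ-reject ¬px = begin
    length (filter P? (xs ∷ʳ x))                      ≡⟨ cong length (filter-++ P? xs [ x ]) ⟩
    length (filter P? xs ++ filter P? [ x ])          ≡⟨ length-++ (filter P? xs) ⟩
    length (filter P? xs) + length (filter P? [ x ])  ≡⟨ cong (λ ys → ℓxs + length ys) (filter-reject P? ¬px) ⟩
    ℓxs + 0                                           ≡⟨ +-identityʳ ℓxs ⟩
    ℓxs                                               ∎
    where
    open ≡-Reasoning
    ℓxs = length (filter P? xs)

+-telescope : ∀ (f g : ℕ → ℕ) b → (∀ n → n < b → f (suc n) + g n ≡ f n + g (suc n)) →
              ∀ n → n ≤ b → f n + g 0 ≡ f 0 + g n
+-telescope f g b step zero    _     = refl
+-telescope f g b step (suc n) 1+n≤b = +-cancelʳ-≡ (g n) _ _ (begin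
  f (suc n) + g 0 + g n        ≡⟨ xy∙z≈xz∙y (f (suc n)) (g 0) (g n) ⟩
  f (suc n) + g n + g 0        ≡⟨ cong (_+ g 0) (step n 1+n≤b) ⟩
  f n + g (suc n) + g 0        ≡⟨ xy∙z≈xz∙y (f n) (g (suc n)) (g 0) ⟩
  f n + g 0 + g (suc n)        ≡⟨ cong (_+ g (suc n)) (+-telescope f g b step n (<⇒≤ 1+n≤b)) ⟩
  f 0 + g n + g (suc n)        ≡⟨ xy∙z≈xz∙y (f 0) (g n) (g (suc n)) ⟩
  f 0 + g (suc n) + g n        ∎)
  where open ≡-Reasoning

m+n≡o⇒+m≡+o-+n : ∀ {m n o} → m + n ≡ o → + m ≡ + o - + n
m+n≡o⇒+m≡+o-+n {m} {n} refl = begin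
  + m                  ≡⟨ cong +_ (m+n∸n≡m m n) ⟨
  + (m + n ∸ n)        ≡⟨ ⊖-≥ (m≤n+m n m) ⟨
  (m + n) ℤ.⊖ n        ≡⟨ m-n≡m⊖n (m + n) n ⟨
  + (m + n) - + n      ∎
  where open ≡-Reasoning

module NonSquare (q : ℕ) (nonSquare : ¬ ∃ λ k → k * k ≡ suc q) where

  r : ℕ
  r = suc q

  s : ℕ
  s = isqrt r

  F : ℕ → ℕ
  F = floorMulSqrt r

  M : ℕ → ℕ
  M = floorDivSqrt r

  s*s<r : s * s < r
  s*s<r = ≤∧≢⇒< (proj₁ (isqrt-spec r)) (λ s*s≡r → nonSquare (s , s*s≡r))

  r<[1+s]² : r < suc s * suc s
  r<[1+s]² = proj₂ (isqrt-spec r)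

  a*a*r≢b*b : ∀ a b → .{{NonZero a}} → a * a * r ≢ b * b
  a*a*r≢b*b a b e = nonSquare (a*a*r≡b*b⇒∃[k]k*k≡r a b r e)

  F-superadditive : ∀ a b → F a + F b ≤ F (a + b)
  F-superadditive a b = m*m≤n⇒m≤isqrt ([x+y]²≤[a+b]²r {F a} {a} {r} {F b} {b}
    (proj₁ (isqrt-spec (a * a * r))) (proj₁ (isqrt-spec (b * b * r))))

  F-subadditive : ∀ a b → F (a + b) ≤ suc (F a + F b)
  F-subadditive a b = subst (F (a + b) ≤_) (+-suc (F a) (F b)) (≤-pred (n<m*m⇒isqrt<m
    ([a+b]²r<[x+y]² {a} {r} {suc (F a)} {b} {suc (F b)}
      (<⇒≤ (proj₂ (isqrt-spec (a * a * r)))) (proj₂ (isqrt-spec (b * b * r))))))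

  F[s]<r : F s < r
  F[s]<r = n<m*m⇒isqrt<m (*-monoˡ-< r s*s<r)

  r≤F[1+s] : r ≤ F (suc s)
  r≤F[1+s] = m*m≤n⇒m≤isqrt (*-monoˡ-≤ r (<⇒≤ r<[1+s]²))

  q≤F[a]+F[b] : ∀ a b → a + b ≡ suc s → q ≤ F a + F b
  q≤F[a]+F[b] a b a+b≡1+s =
    s≤s⁻¹ (≤-trans r≤F[1+s] (subst (λ c → F c ≤ suc (F a + F b)) a+b≡1+s (F-subadditive a b)))

  F[a]+F[b]<r : ∀ a b → a + b ≡ s → F a + F b < r
  F[a]+F[b]<r a b a+b≡s = ≤-<-trans (F-superadditive a b) (subst (λ c → F c < r) (sym a+b≡s) F[s]<r)

  k*s≤F[k] : ∀ k → k * s ≤ F k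
  k*s≤F[k] k = m*m≤n⇒m≤isqrt
    (subst (_≤ k * k * r) (sym ([x*y]²≡x²*y² k s)) (*-monoʳ-≤ (k * k) (<⇒≤ s*s<r)))

  M-lower : ∀ j → M j * M j * r ≤ j * j
  M-lower j = proj₁ (floorDivSqrt-spec r j)

  M-upper : ∀ j → j * j < suc (M j) * suc (M j) * r
  M-upper j = proj₂ (floorDivSqrt-spec r j)

  M≤s : ∀ {j} → j ≤ r → M j ≤ s
  M≤s {j} j≤r = m*m≤n⇒m≤isqrt (*-cancelʳ-≤ (M j * M j) r r (≤-trans (M-lower j) (*-mono-≤ j≤r j≤r)))

  M[r]≡s : M r ≡ s
  M[r]≡s = sym (isqrt-unique (*-cancelʳ-≤ (M r * M r) r r (M-lower r))
                             (*-cancelʳ-< r r (suc (M r) * suc (M r)) (M-upper r)))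

  F[M[1+n]]≡n : ∀ n → M (suc n) ≡ suc (M n) → F (M (suc n)) ≡ n
  F[M[1+n]]≡n n e = isqrt-unique
    (<⇒≤ (subst (λ m → n * n < m * m * r) (sym e) (M-upper n)))
    (≤∧≢⇒< (M-lower (suc n)) (subst (λ m → m * m * r ≢ suc n * suc n) (sym e) (a*a*r≢b*b (suc (M n)) (suc n))))

  below-beta⇔ : ∀ {j} → j ≤ r → FracBelowBeta r j ⇔ F (s ∸ M j) + j < r
  below-beta⇔ {j} j≤r = mk⇔
    (λ below → m≤o∸n⇒m+n≤o (suc (F (s ∸ M j))) j≤r (n<m*m⇒isqrt<m below))
    (λ lt → isqrt<m⇒n<m*m (m+n≤o⇒m≤o∸n (suc (F (s ∸ M j))) lt))

  C : ℕ → ℕ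
  C n = length (filter (fracBelowBeta? r) (map suc (upTo n)))

  C-suc-accept : ∀ n → FracBelowBeta r (suc n) → C (suc n) ≡ suc (C n)
  C-suc-accept n below = trans (cong (λ xs → length (filter (fracBelowBeta? r) xs)) (map-upTo-suc suc n))
                               (length-filter-∷ʳ-accept (fracBelowBeta? r) (map suc (upTo n)) below)

  C-suc-reject : ∀ n → ¬ FracBelowBeta r (suc n) → C (suc n) ≡ C n
  C-suc-reject n ¬below = trans (cong (λ xs → length (filter (fracBelowBeta? r) xs)) (map-upTo-suc suc n))
                                (length-filter-∷ʳ-reject (fracBelowBeta? r) (map suc (upTo n)) ¬below)

  count-step : ∀ n m → M (suc n) ≡ m → suc n ≤ r →
               C (suc n) + (F (s ∸ m) + n) ⊓ q ≡ C n + (F (s ∸ m) + suc n) ⊓ q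
  count-step n m refl 1+n≤r with fracBelowBeta? r (suc n)
  ... | yes below = begin
    C (suc n) + (X + n) ⊓ q      ≡⟨ cong₂ _+_ (C-suc-accept n below) (m≤n⇒m⊓n≡m (<⇒≤ X+n<q)) ⟩
    suc (C n) + (X + n)          ≡⟨ +-suc (C n) (X + n) ⟨
    C n + suc (X + n)            ≡⟨ cong (_+_ (C n)) (+-suc X n) ⟨
    C n + (X + suc n)            ≡⟨ cong (_+_ (C n)) (m≤n⇒m⊓n≡m X+1+n≤q) ⟨
    C n + (X + suc n) ⊓ q        ∎
    where
    open ≡-Reasoning
    X = F (s ∸ M (suc n))
    X+1+n≤q : X + suc n ≤ q
    X+1+n≤q = s≤s⁻¹ (Equivalence.to (below-beta⇔ {suc n} 1+n≤r) below)
    X+n<q : X + n < q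
    X+n<q = subst (_≤ q) (+-suc X n) X+1+n≤q
  ... | no ¬below =
    cong₂ _+_ (C-suc-reject n ¬below) (trans (m≥n⇒m⊓n≡n q≤X+n) (sym (m≥n⇒m⊓n≡n q≤X+1+n)))
    where
    X = F (s ∸ M (suc n))
    q≤X+n : q ≤ X + n
    q≤X+n = s≤s⁻¹ (subst (r ≤_) (+-suc X n)
      (≮⇒≥ (λ lt → ¬below (Equivalence.from (below-beta⇔ {suc n} 1+n≤r) lt))))
    q≤X+1+n : q ≤ X + suc n
    q≤X+1+n = ≤-trans q≤X+n (+-monoʳ-≤ X (n≤1+n n))

  S : ℕ → ℕ
  S k = sum (map F (upTo k))

  -- For n in block m, Pot m n − S (suc m) − S (suc s) is C n: each earlier
  -- block m′ contributes q − F m′ − F (s − m′), and block m the j ≤ n with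
  -- F (s − m) + j ≤ q.
  Pot : ℕ → ℕ → ℕ
  Pot m n = m * q + (F (s ∸ m) + n) ⊓ q + S (s ∸ m)

  private
    regroup : ∀ c s₁ u a s₂ → c + s₁ + (u + a + s₂) ≡ (c + a) + (s₁ + u + s₂)
    regroup = solve-∀

    regroup′ : ∀ c s₁ n u v s₂ f → c + (s₁ + n) + (u + v + (s₂ + f)) ≡ (c + (f + n)) + (s₁ + (v + u) + s₂)
    regroup′ = solve-∀

  balance-within-block : ∀ n → M (suc n) ≡ M n → suc n ≤ r →
    C (suc n) + S (suc (M (suc n))) + Pot (M n) n ≡ C n + S (suc (M n)) + Pot (M (suc n)) (suc n)
  balance-within-block n e 1+n≤r rewrite e = begin
    C (suc n) + S₁ + (m * q + A + S₂)   ≡⟨ regroup (C (suc n)) S₁ (m * q) A S₂ ⟩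
    (C (suc n) + A) + (S₁ + m * q + S₂) ≡⟨ cong (_+ (S₁ + m * q + S₂)) (count-step n m e 1+n≤r) ⟩
    (C n + A′) + (S₁ + m * q + S₂)      ≡⟨ regroup (C n) S₁ (m * q) A′ S₂ ⟨
    C n + S₁ + (m * q + A′ + S₂)        ∎
    where
    open ≡-Reasoning
    m = M n
    A = (F (s ∸ m) + n) ⊓ q
    A′ = (F (s ∸ m) + suc n) ⊓ q
    S₁ = S (suc m)
    S₂ = S (s ∸ m)

  balance-across-blocks : ∀ n → M (suc n) ≡ suc (M n) → suc n ≤ r →
    C (suc n) + S (suc (M (suc n))) + Pot (M n) n ≡ C n + S (suc (M n)) + Pot (M (suc n)) (suc n)
  balance-across-blocks n e 1+n≤r rewrite e = begin
    C (suc n) + S (suc (suc m)) + Pot m n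
      ≡⟨ cong₂ (λ u v → C (suc n) + u + v) S[2+m]≡S[1+m]+n Pot[m,n]≡ ⟩
    C (suc n) + (S (suc m) + n) + (m * q + q + (S d + F d))
      ≡⟨ regroup′ (C (suc n)) (S (suc m)) n (m * q) q (S d) (F d) ⟩
    (C (suc n) + (F d + n)) + (S (suc m) + suc m * q + S d)
      ≡⟨ cong (_+ (S (suc m) + suc m * q + S d)) C[1+n]+F[d]+n≡C[n]+A′ ⟩
    (C n + A′) + (S (suc m) + suc m * q + S d)
      ≡⟨ regroup (C n) (S (suc m)) (suc m * q) A′ (S d) ⟨
    C n + S (suc m) + Pot (suc m) (suc n) ∎
    where
    open ≡-Reasoning
    m = M n
    d = s ∸ suc m
    A′ = (F d + suc n) ⊓ q
    1+m≤s : suc m ≤ s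
    1+m≤s = subst (_≤ s) e (M≤s 1+n≤r)
    s∸m≡1+d : s ∸ m ≡ suc d
    s∸m≡1+d = +-∸-assoc 1 1+m≤s
    1+m+d≡s : suc m + d ≡ s
    1+m+d≡s = m+[n∸m]≡n 1+m≤s
    F[1+m]≡n : F (suc m) ≡ n
    F[1+m]≡n = subst (λ c → F c ≡ n) e (F[M[1+n]]≡n n e)
    F[d]+n≤q : F d + n ≤ q
    F[d]+n≤q = s≤s⁻¹ (subst (_< r) (trans (cong (_+ F d) F[1+m]≡n) (+-comm n (F d)))
                             (F[a]+F[b]<r (suc m) d 1+m+d≡s))
    C[1+n]+F[d]+n≡C[n]+A′ : C (suc n) + (F d + n) ≡ C n + A′
    C[1+n]+F[d]+n≡C[n]+A′ = trans (cong (_+_ (C (suc n))) (sym (m≤n⇒m⊓n≡m F[d]+n≤q)))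
                                  (count-step n (suc m) e 1+n≤r)
    q≤F[1+d]+n : q ≤ F (suc d) + n
    q≤F[1+d]+n = subst (λ c → q ≤ F (suc d) + c) F[1+m]≡n
                   (q≤F[a]+F[b] (suc d) (suc m) (cong suc (trans (+-comm d (suc m)) 1+m+d≡s)))
    S[2+m]≡S[1+m]+n : S (suc (suc m)) ≡ S (suc m) + n
    S[2+m]≡S[1+m]+n = trans (sum-map-upTo-suc F (suc m)) (cong (_+_ (S (suc m))) F[1+m]≡n)
    Pot[m,n]≡ : Pot m n ≡ m * q + q + (S d + F d)
    Pot[m,n]≡ = begin
      m * q + (F (s ∸ m) + n) ⊓ q + S (s ∸ m)  ≡⟨ cong (λ c → m * q + (F c + n) ⊓ q + S c) s∸m≡1+d ⟩
      m * q + (F (suc d) + n) ⊓ q + S (suc d)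
        ≡⟨ cong₂ (λ u v → m * q + u + v) (m≥n⇒m⊓n≡n q≤F[1+d]+n) (sum-map-upTo-suc F d) ⟩
      m * q + q + (S d + F d)                  ∎

  balance : ∀ n → n < r →
    C (suc n) + S (suc (M (suc n))) + Pot (M n) n ≡ C n + S (suc (M n)) + Pot (M (suc n)) (suc n)
  balance n 1+n≤r with floorDivSqrt-suc r n
  ... | inj₁ e = balance-within-block n e 1+n≤r
  ... | inj₂ e = balance-across-blocks n e 1+n≤r

  Pot[0,0]≡S[1+s] : Pot 0 0 ≡ S (suc s)
  Pot[0,0]≡S[1+s] = begin
    (F s + 0) ⊓ q + S s   ≡⟨ cong (λ c → c ⊓ q + S s) (+-identityʳ (F s)) ⟩
    F s ⊓ q + S s         ≡⟨ cong (_+ S s) (m≤n⇒m⊓n≡m (s≤s⁻¹ F[s]<r)) ⟩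
    F s + S s             ≡⟨ +-comm (F s) (S s) ⟩
    S s + F s             ≡⟨ sum-map-upTo-suc F s ⟨
    S (suc s)             ∎
    where open ≡-Reasoning

  Pot[s,r]≡[1+s]*q : Pot s r ≡ suc s * q
  Pot[s,r]≡[1+s]*q = begin
    s * q + (F (s ∸ s) + r) ⊓ q + S (s ∸ s)  ≡⟨ cong (λ c → s * q + (F c + r) ⊓ q + S c) (n∸n≡0 s) ⟩
    s * q + r ⊓ q + 0                         ≡⟨ cong (λ c → s * q + c + 0) (m≥n⇒m⊓n≡n (n≤1+n q)) ⟩
    s * q + q + 0                             ≡⟨ +-identityʳ (s * q + q) ⟩
    s * q + q                                 ≡⟨ +-comm (s * q) q ⟩
    suc s * q                                 ∎
    where open ≡-Reasoning

  ¬below-beta[r] : ¬ FracBelowBeta r r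
  ¬below-beta[r] below = n≮0 (subst (λ c → (s ∸ M r) * (s ∸ M r) * r < c * c) (n∸n≡0 q) below)

  count-below-beta : C q + 2 * S (suc s) ≡ suc s * q
  count-below-beta = begin
    C q + 2 * S (suc s)             ≡⟨ cong (_+ 2 * S (suc s)) (C-suc-reject q ¬below-beta[r]) ⟨
    C r + 2 * S (suc s)             ≡⟨ regroup″ (C r) (S (suc s)) ⟩
    C r + S (suc s) + S (suc s)     ≡⟨ cong₂ (λ m c → C r + S (suc m) + c) M[r]≡s Pot[0,0]≡S[1+s] ⟨
    C r + S (suc (M r)) + Pot 0 0
      ≡⟨ +-telescope (λ n → C n + S (suc (M n))) (λ n → Pot (M n) n) r balance r ≤-refl ⟩
    Pot (M r) r                     ≡⟨ cong (λ m → Pot m r) M[r]≡s ⟩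
    Pot s r                         ≡⟨ Pot[s,r]≡[1+s]*q ⟩
    suc s * q                       ∎
    where
    open ≡-Reasoning
    regroup″ : ∀ c x → c + 2 * x ≡ c + x + x
    regroup″ = solve-∀

  F≡k*s+floorMulBeta : ∀ k → F k ≡ k * s + floorMulBeta r k
  F≡k*s+floorMulBeta k = sym (m+[n∸m]≡n (k*s≤F[k] k))

  2*S≡ : ∀ k → 2 * S (suc k) ≡ k * suc k * s + 2 * sumFloorBeta r k
  2*S≡ zero = refl
  2*S≡ (suc k) = begin
    2 * S (suc (suc k))
      ≡⟨ cong (2 *_) (sum-map-upTo-suc F (suc k)) ⟩
    2 * (S (suc k) + F (suc k))
      ≡⟨ *-distribˡ-+ 2 (S (suc k)) (F (suc k)) ⟩
    2 * S (suc k) + 2 * F (suc k)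
      ≡⟨ cong₂ (λ u v → u + 2 * v) (2*S≡ k) (F≡k*s+floorMulBeta (suc k)) ⟩
    k * suc k * s + 2 * T k + 2 * (suc k * s + floorMulBeta r (suc k))
      ≡⟨ regroup‴ k s (T k) (floorMulBeta r (suc k)) ⟩
    suc k * suc (suc k) * s + 2 * (T k + floorMulBeta r (suc k))
      ≡⟨ cong (λ c → suc k * suc (suc k) * s + 2 * c) (sum-map-upTo-suc (λ i → floorMulBeta r (suc i)) k) ⟨
    suc k * suc (suc k) * s + 2 * T (suc k)
      ∎
    where
    open ≡-Reasoning
    T = sumFloorBeta r
    regroup‴ : ∀ k s t f → k * suc k * s + 2 * t + 2 * (suc k * s + f) ≡ suc k * suc (suc k) * s + 2 * (t + f)
    regroup‴ = solve-∀

  N+2*sumFloorBeta≡ : N r + 2 * sumFloorBeta r s ≡ suc s * (q ∸ s * s)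
  N+2*sumFloorBeta≡ = +-cancelʳ-≡ (s * suc s * s) _ _ (begin
    N r + 2 * sumFloorBeta r s + s * suc s * s   ≡⟨ regroup⁗ (N r) (2 * sumFloorBeta r s) (s * suc s * s) ⟩
    N r + (s * suc s * s + 2 * sumFloorBeta r s) ≡⟨ cong (_+_ (N r)) (2*S≡ s) ⟨
    C q + 2 * S (suc s)                          ≡⟨ count-below-beta ⟩
    suc s * q                                    ≡⟨ cong (suc s *_) (m+[n∸m]≡n (s≤s⁻¹ s*s<r)) ⟨
    suc s * (s * s + (q ∸ s * s))                ≡⟨ expand s (q ∸ s * s) ⟩
    suc s * (q ∸ s * s) + s * suc s * s          ∎)
    where
    open ≡-Reasoning
    regroup⁗ : ∀ n t u → n + t + u ≡ n + (u + t)
    regroup⁗ = solve-∀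
    expand : ∀ s d → suc s * (s * s + d) ≡ suc s * d + s * suc s * s
    expand = solve-∀

lemma3p8 : (r : ℕ) → 2 ≤ r → ¬ (∃ λ k → k * k ≡ r) →
    (s t : ℕ) → s ≡ isqrt r → r ≡ s * s + t → 1 ≤ t → t ≤ 2 * s →
    + N r ≡ + ((s + 1) * (t ∸ 1)) - + (2 * sumFloorBeta r s)
lemma3p8 zero () _ _ _ _ _ _ _
lemma3p8 (suc q) _ _ _ zero _ _ () _
lemma3p8 (suc q) _ nonSquare s (suc t′) refl r≡s*s+t _ _ =
  m+n≡o⇒+m≡+o-+n (trans (NonSquare.N+2*sumFloorBeta≡ q nonSquare) (cong₂ _*_ (+-comm 1 s) q∸s*s≡t′))
  where
  q∸s*s≡t′ : q ∸ s * s ≡ t′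
  q∸s*s≡t′ = trans (cong (_∸ s * s) (suc-injective (trans r≡s*s+t (+-suc (s * s) t′)))) (m+n∸m≡n (s * s) t′)
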